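{- Let X be E or S. If the programming language is end-of-file data segment and has a blank character, then $$\forall T \in \textnormal{three-way(X)}: \exists c_T > 0: \exists n_T \in \mathbb{N}: \forall n \geq n_T: \frac{\overline h_T(n)}{p(n)} \geq c_T \wedge \frac{\overline d_T(n)}{p(n)} \geq c_T .$$
   Context: Programs are strings over a finite alphabet $\Sigma$ ($|\Sigma|\ge2$) in a Turing-complete programming language in which programs can construct, test and simulate other programs; each program on each input halts or runs forever; $p(n)$ is the number of programs of size (length) $n$. The language is end-of-file data segment if each program is the concatenation of an actual program, written in a self-delimiting language (the set of actual programs is decidable and none is a proper prefix of another), and a data segment, an arbitrary string over $\Sigma$ extending to the end of the file; the language has a construct via which the actual program can read the contents of the data segment. A blank character is a character that, for any program, can be inserted at at least one place in the program without affecting the meaning of the program. Variants: E — instances are programs, question: does the program halt on the empty input; S — instances are programs, question: does the program halt when given itself as input. A three-way tester for X is a program that on every instance halts with ``yes'', ``no'' or ``I don't know'', where ``yes'' is only given on halting and ``no'' only on non-halting instances; three-way(X) is the set of these. An instance is hard for $T$ if $T$ answers ``I don't know'' on it. $\overline h_T(n)$ and $\overline d_T(n)$ are the numbers of hard halting and hard non-halting instances of size $n$. -}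

module Defs where

open import Data.Nat using (ℕ; zero; suc; _≤_; _*_)
open import Data.Fin using (Fin; zero; suc)
open import Data.Fin.Base using (Fin)
open import Data.List using (List; []; _∷_; _++_; map; concatMap; length; filter; take; drop; intercalate; allFin)
open import Data.List.Relation.Unary.All using (All)
open import Data.List.Relation.Unary.Unique.Propositional using (Unique)
open import Data.Maybe using (Maybe; just; nothing)
open import Data.Product using (Σ; ∃; ∃₂; _×_; _,_)
open import Data.Sum using (_⊎_)
open import Data.Empty using (⊥)
open import Relation.Nullary using (¬_)
open import Relation.Unary using (Decidable)
open import Relation.Binary.PropositionalEquality using (_≡_; _≢_)
open import Function.Bundles using (_⇔_)

Word : ℕ → Set
Word k = List (Fin k)

allWords : (k : ℕ) → ℕ → List (Word k)
allWords k zero = [] ∷ []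
allWords k (suc n) = concatMap (λ c → map (c ∷_) (allWords k n)) (allFin k)

-- Reference model of computation: deterministic Turing machines over
-- input alphabet Fin k, two-way infinite tape, extra work symbols, a
-- blank and an argument separator.

data Sym (k m : ℕ) : Set where
  blank : Sym k m
  sep   : Sym k m
  inp   : Fin k → Sym k m
  wrk   : Fin m → Sym k m

data Move : Set where
  left right stay : Move

record TM (k : ℕ) : Set where
  field
    states : ℕ          -- states are Fin (suc states); state zero is initial
    extra  : ℕ
    -- nothing = halt
    δ : Fin (suc states) → Sym k extra →
        Maybe (Fin (suc states) × Sym k extra × Move)

record Config (k : ℕ) (M : TM k) : Set where
  constructor conf
  field
    state : Fin (suc (TM.states M))
    lft   : List (Sym k (TM.extra M))   -- cells left of head, nearest first
    hd    : Sym k (TM.extra M)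
    rgt   : List (Sym k (TM.extra M))   -- cells right of head, nearest first

module _ {k : ℕ} (M : TM k) where
  private
    S = Sym k (TM.extra M)

  doMove : Fin (suc (TM.states M)) → List S → S → List S → Move → Config k M
  doMove q [] h r left = conf q [] blank (h ∷ r)
  doMove q (l ∷ ls) h r left = conf q ls l (h ∷ r)
  doMove q ls h [] right = conf q (h ∷ ls) blank []
  doMove q ls h (x ∷ rs) right = conf q (h ∷ ls) x rs
  doMove q ls h r stay = conf q ls h r

  step : Config k M → Maybe (Config k M)
  step (conf q ls h r) with TM.δ M q h
  ... | nothing = nothing
  ... | just (q' , s , mv) = just (doMove q' ls s r mv)

  exec : ℕ → Config k M → Maybe (Config k M)
  exec t c with step c
  exec t c       | nothing = just c
  exec zero c    | just _  = nothing
  exec (suc t) c | just c' = exec t c'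

  initConf : List (Word k) → Config k M
  initConf args with intercalate (sep ∷ []) (map (map inp) args)
  ... | [] = conf zero [] blank []
  ... | s ∷ r = conf zero [] s r

  readOut : List S → Word k
  readOut (inp a ∷ r) = a ∷ readOut r
  readOut _ = []

  TMEval : List (Word k) → Word k → Set
  TMEval args y = ∃ λ t → ∃ λ c →
    exec t (initConf args) ≡ just c × readOut (Config.hd c ∷ Config.rgt c) ≡ y

  TMDecides : (Word k → Set) → Set
  TMDecides P = ∀ w → ∃ λ y → TMEval (w ∷ []) y × (P w ⇔ y ≡ [])

record Language (k : ℕ) : Set₁ where
  field
    IsProg   : Word k → Set
    isProg?  : Decidable IsProg
    -- Eval p x y : program p on input x halts with output y
    Eval     : Word k → Word k → Word k → Set
    -- the three answer strings of a tester
    yes no idk : Word k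
    yes≢no   : yes ≢ no
    yes≢idk  : yes ≢ idk
    no≢idk   : no ≢ idk
    testable : ∃ λ (M : TM k) → TMDecides M IsProg
    complete : ∀ (M : TM k) → ∃ λ p → IsProg p ×
                 (∀ x y → Eval p x y ⇔ TMEval M (x ∷ []) y)
    simulable : ∃ λ (U : TM k) → ∀ p x y → IsProg p →
                 (Eval p x y ⇔ TMEval U (p ∷ x ∷ []) y)

module _ {k : ℕ} (L : Language k) where
  open Language L

  Halts : Word k → Word k → Set
  Halts p x = ∃ λ y → Eval p x y

  SameMeaning : Word k → Word k → Set
  SameMeaning p q = ∀ x y → Eval p x y ⇔ Eval q x y

  progCount : ℕ → ℕ
  progCount n = length (filter isProg? (allWords k n))

  record EOFDataSegment : Set₁ where
    field
      Actual     : Word k → Set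
      actualDec  : ∃ λ (M : TM k) → TMDecides M Actual
      prefixFree : ∀ a e → Actual a → Actual (a ++ e) → e ≡ []
      programs   : ∀ w → IsProg w ⇔ (∃₂ λ a d → Actual a × w ≡ a ++ d)
      readData   : ∀ (M : TM k) → ∃ λ a → Actual a ×
                     (∀ d x y → Eval (a ++ d) x y ⇔ TMEval M (d ∷ x ∷ []) y)

  insertAt : ℕ → Fin k → Word k → Word k
  insertAt i b w = take i w ++ (b ∷ drop i w)

  IsBlank : Fin k → Set
  IsBlank b = ∀ p → IsProg p → ∃ λ i → i ≤ length p ×
                IsProg (insertAt i b p) × SameMeaning p (insertAt i b p)

  HasBlank : Set
  HasBlank = ∃ λ b → IsBlank b

data Variant : Set where
  E S : Variant

instInput : {k : ℕ} → Variant → Word k → Word k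
instInput E q = []
instInput S q = q

module _ {k : ℕ} (L : Language k) (X : Variant) where
  open Language L

  XHalts : Word k → Set
  XHalts q = Halts L q (instInput X q)

  ThreeWay : Word k → Set
  ThreeWay T = IsProg T × (∀ q → IsProg q →
      (Eval T q yes ⊎ Eval T q no ⊎ Eval T q idk) ×
      (Eval T q yes → XHalts q) ×
      (Eval T q no → ¬ XHalts q))

  Hard : Word k → Word k → Set
  Hard T q = Eval T q idk

  -- h̄_T(n) / p(n) ≥ 1/(suc c): there are at least p(n)/(suc c)
  -- distinct hard halting instances of size n
  HardHaltBound : Word k → ℕ → ℕ → Set
  HardHaltBound T c n = ∃ λ (qs : List (Word k)) → Unique qs ×
    All (λ q → length q ≡ n × IsProg q × Hard T q × XHalts q) qs ×
    progCount L n ≤ suc c * length qs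

  HardNonHaltBound : Word k → ℕ → ℕ → Set
  HardNonHaltBound T c n = ∃ λ (qs : List (Word k)) → Unique qs ×
    All (λ q → length q ≡ n × IsProg q × Hard T q × ¬ XHalts q) qs ×
    progCount L n ≤ suc c * length qs

-- For an answer w and a bit b there is a Turing machine that, given a data segment d and an input,
-- rebuilds the whole program q = a ++ d from d, runs the tester T on q through the universal machine
-- of `simulable`, and halts exactly if "T answers w on q" agrees with b. By readData this machine is
-- realised by an actual program a, and storing a in its own data segment makes every program
-- q = pre ++ r (pre = a ++ tagged (reverse a) ++ [1], r arbitrary) contradict T whenever T answers w.
-- For (w , b) = (yes , false) T can answer neither yes nor no on q, so it answers "I don't know" and
-- q halts; for (no , true) it answers "I don't know" and q runs forever. The strings of length
-- n ≥ |pre| with prefix pre form a fraction k^-|pre| of all strings of length n, so at least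
-- p(n)/k^|pre| programs of size n are hard halting instances; likewise for non-halting ones.

module Submission where

open import Defs
open import Data.Nat using (ℕ; zero; suc; pred; _+_; _*_; _^_; _≤_; _∸_; _⊔_; s≤s; z≤n)
open import Data.Nat.Properties
  using (module ≤-Reasoning; ≤-trans; ≤-reflexive; m+[n∸m]≡n; ^-distribˡ-+-*; *-monoˡ-≤;
         m≤m+n; m≤n+m; n≤1+n; m≤m⊔n; m≤n⊔m)
open import Data.Fin using (Fin; zero; suc; join; splitAt)
open import Data.Fin.Properties using (splitAt-join; _≟_)
open import Data.Fin.Patterns using (0F; 1F; 2F; 3F; 4F; 5F; 6F; 7F; 8F; 9F)
open import Data.Bool using (Bool; true; false; not)
open import Data.Sum using (_⊎_; inj₁; inj₂; [_,_]′)
import Data.Sum as Sum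
open import Data.List
  using (List; []; _∷_; _++_; map; length; reverse; _ʳ++_; concatMap; allFin; cartesianProductWith)
open import Data.List.Properties
  using (++-assoc; ++-identityʳ; ʳ++-defn; ++-ʳ++; ʳ++-ʳ++; map-++; map-ʳ++; length-map; length-++;
         length-tabulate; length-filter; ∷-injective; ++-cancelˡ)
open import Data.List.Relation.Unary.All using (All; []; _∷_; universal)
import Data.List.Relation.Unary.All as All
open import Data.List.Relation.Unary.All.Properties using (++⁺; map⁺)
open import Data.List.Relation.Unary.AllPairs using ([]; _∷_)
open import Data.List.Relation.Unary.Unique.Propositional using (Unique)
import Data.List.Relation.Unary.Unique.Propositional.Properties as Unique
open import Data.Maybe using (Maybe; just; nothing; maybe)
import Data.Maybe as Maybe
open import Data.Maybe.Relation.Binary.Pointwise using (Pointwise; just; nothing; just-inv)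
open import Data.Product using (∃; _×_; _,_; proj₁; proj₂)
open import Data.Empty using (⊥-elim)
open import Function using (_∘_)
open import Function.Bundles using (_⇔_; Equivalence; mk⇔)
open import Relation.Nullary using (¬_)
import Relation.Nullary.Decidable as Dec
open import Relation.Binary.PropositionalEquality
open import Relation.Binary.Construct.Closure.ReflexiveTransitive using (Star; ε; _◅_; _◅◅_; gmap)
open import Relation.Binary.Construct.Closure.ReflexiveTransitive.Properties using (module StarReasoning)


ʳ++⁺ : ∀ {A : Set} {P : A → Set} {xs ys} → All P xs → All P ys → All P (xs ʳ++ ys)
ʳ++⁺ []         pys = pys
ʳ++⁺ (px ∷ pxs) pys = ʳ++⁺ pxs (px ∷ pys)

ʳ++-++ : ∀ {A : Set} (xs : List A) {ys zs} → xs ʳ++ (ys ++ zs) ≡ (xs ʳ++ ys) ++ zs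
ʳ++-++ xs {ys} {zs} =
  trans (ʳ++-defn xs) (trans (sym (++-assoc (reverse xs) ys zs)) (cong (_++ zs) (sym (ʳ++-defn xs))))

module _ {A B C : Set} (f : A → B → C) where

  length-cartesianProductWith : ∀ xs ys → length (cartesianProductWith f xs ys) ≡ length xs * length ys
  length-cartesianProductWith []       ys = refl
  length-cartesianProductWith (x ∷ xs) ys =
    trans (length-++ (map (f x) ys)) (cong₂ _+_ (length-map (f x) ys) (length-cartesianProductWith xs ys))

  All-cartesianProductWith : ∀ {P : C → Set} xs ys → (∀ x → All (λ y → P (f x y)) ys) →
                             All P (cartesianProductWith f xs ys)
  All-cartesianProductWith []       ys pf = []
  All-cartesianProductWith (x ∷ xs) ys pf = ++⁺ (map⁺ (pf x)) (All-cartesianProductWith xs ys pf)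

concatMap≡cartesianProductWith : ∀ {A B C : Set} (f : A → B → C) xs ys →
  concatMap (λ x → map (f x) ys) xs ≡ cartesianProductWith f xs ys
concatMap≡cartesianProductWith f []       ys = refl
concatMap≡cartesianProductWith f (x ∷ xs) ys = cong (map (f x) ys ++_) (concatMap≡cartesianProductWith f xs ys)


-- Runs of deterministic machines

module Runs {C : Set} (step : C → Maybe C) where

  infix 4 _↝_ _↝*_

  data _↝_ (c c' : C) : Set where
    stepped : step c ≡ just c' → c ↝ c'

  _↝*_ : C → C → Set
  _↝*_ = Star _↝_

  Halted : C → Set
  Halted c = step c ≡ nothing

  ↝*-det : ∀ {c c' h} → c ↝* h → Halted h → c ↝* c' → c' ↝* h
  ↝*-det run               halted ε = run
  ↝*-det ε                 halted (stepped s ◅ _) with () ← trans (sym halted) s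
  ↝*-det (stepped s ◅ run) halted (stepped s' ◅ run') with refl ← trans (sym s) s' = ↝*-det run halted run'

module Simulation {C D : Set} (stepC : C → Maybe C) (stepD : D → Maybe D) (f : C → D)
  (commutes : ∀ c → stepD (f c) ≡ Maybe.map f (stepC c)) where

  private
    module RC = Runs stepC
    module RD = Runs stepD

  commutes-just : ∀ {c c'} → stepC c ≡ just c' → stepD (f c) ≡ just (f c')
  commutes-just {c} s = trans (commutes c) (cong (Maybe.map f) s)

  map-↝* : ∀ {c c'} → c RC.↝* c' → f c RD.↝* f c'
  map-↝* = gmap f (λ { (RC.stepped s) → RD.stepped (commutes-just s) })

  map-Halted : ∀ {c} → RC.Halted c → RD.Halted (f c)
  map-Halted {c} halted = trans (commutes c) (cong (Maybe.map f) halted)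

  reflect-halting : ∀ c {h} → f c RD.↝* h → RD.Halted h → ∃ λ g → c RC.↝* g × RC.Halted g
  reflect-halting c run halted with stepC c in eq
  ... | nothing = c , ε , eq
  reflect-halting c ε halted | just c' with () ← trans (sym halted) (commutes-just eq)
  reflect-halting c (RD.stepped s ◅ run) halted | just c'
    with refl ← trans (sym s) (commutes-just eq) | reflect-halting c' run halted
  ... | g , run' , halted' = g , RC.stepped eq ◅ run' , halted'

module TMRuns {k : ℕ} (M : TM k) where
  open Runs (step M) public

  exec⇒↝* : ∀ t c h → exec M t c ≡ just h → c ↝* h × Halted h
  exec⇒↝* t c h e with step M c in eq
  exec⇒↝* t       c .c refl | nothing = ε , eq
  exec⇒↝* (suc t) c h  e    | just c' with exec⇒↝* t c' h e
  ... | r , hl = stepped eq ◅ r , hl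

  ↝*⇒exec : ∀ {c h} → c ↝* h → Halted h → ∃ λ t → exec M t c ≡ just h
  ↝*⇒exec {c} ε hl rewrite hl = zero , refl
  ↝*⇒exec {c} (stepped s ◅ r) hl with ↝*⇒exec r hl
  ... | t , e rewrite s = suc t , e


-- Turing machines over arbitrary state sets

Tape : ℕ → ℕ → Set
Tape k m = List (Sym k m)

Blanks : ∀ {k m} → Tape k m → Set
Blanks = All (_≡ blank)

readInput : ∀ {k m} → Tape k m → Word k
readInput (inp a ∷ r) = a ∷ readInput r
readInput _           = []

readOut≡readInput : ∀ {k} (M : TM k) xs → readOut M xs ≡ readInput xs
readOut≡readInput M []          = refl
readOut≡readInput M (blank ∷ _) = refl
readOut≡readInput M (sep ∷ _)   = refl
readOut≡readInput M (inp a ∷ r) = cong (a ∷_) (readOut≡readInput M r)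
readOut≡readInput M (wrk _ ∷ _) = refl

record Cfg (A : Set) (k m : ℕ) : Set where
  constructor cfg
  field
    state : A
    lft   : Tape k m
    hd    : Sym k m
    rgt   : Tape k m

module _ {k m : ℕ} where

  data LeftEnd : Tape k m → Set where
    []    : LeftEnd []
    blank : LeftEnd (blank ∷ [])

  infix 4 _≼_

  data _≼_ : Tape k m → Tape k m → Set where
    []  : ∀ {ys} → Blanks ys → [] ≼ ys
    _∷_ : ∀ x {xs ys} → xs ≼ ys → x ∷ xs ≼ x ∷ ys

  ≼-++ : ∀ xs {pad} → Blanks pad → xs ≼ xs ++ pad
  ≼-++ []       bs = [] bs
  ≼-++ (x ∷ xs) bs = x ∷ ≼-++ xs bs

  readInput-≼ : ∀ {xs ys} → xs ≼ ys → readInput xs ≡ readInput ys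
  readInput-≼ ([] [])          = refl
  readInput-≼ ([] (refl ∷ _))  = refl
  readInput-≼ (blank ∷ _)      = refl
  readInput-≼ (sep ∷ _)        = refl
  readInput-≼ (inp a ∷ p)      = cong (a ∷_) (readInput-≼ p)
  readInput-≼ (wrk _ ∷ _)      = refl

module _ {k m : ℕ} {A : Set} where

  onRight : A → Tape k m → Tape k m → Cfg A k m
  onRight q l []       = cfg q l blank []
  onRight q l (x ∷ xs) = cfg q l x xs

  onLeft : A → Tape k m → Tape k m → Cfg A k m
  onLeft q []       r = cfg q [] blank r
  onLeft q (x ∷ xs) r = cfg q xs x r

  move : A → Tape k m → Sym k m → Tape k m → Move → Cfg A k m
  move q l h r left  = onLeft q l (h ∷ r)
  move q l h r right = onRight q (h ∷ l) r
  move q l h r stay  = cfg q l h r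

  onLeft-LeftEnd : ∀ {e} q r → LeftEnd e → onLeft q e r ≡ cfg q [] blank r
  onLeft-LeftEnd q r []    = refl
  onLeft-LeftEnd q r blank = refl

  infix 4 _≼ᶜ_

  data _≼ᶜ_ : Cfg A k m → Cfg A k m → Set where
    cfg : ∀ q {l l' h r r'} → l ≼ l' → r ≼ r' → cfg q l h r ≼ᶜ cfg q l' h r'

  onRight-≼ : ∀ q {l l' r r'} → l ≼ l' → r ≼ r' → onRight q l r ≼ᶜ onRight q l' r'
  onRight-≼ q pl ([] [])         = cfg q pl ([] [])
  onRight-≼ q pl ([] (refl ∷ bs)) = cfg q pl ([] bs)
  onRight-≼ q pl (x ∷ pr)        = cfg q pl pr

  onLeft-≼ : ∀ q {l l' r r'} → l ≼ l' → r ≼ r' → onLeft q l r ≼ᶜ onLeft q l' r'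
  onLeft-≼ q ([] [])          pr = cfg q ([] []) pr
  onLeft-≼ q ([] (refl ∷ bs)) pr = cfg q ([] bs) pr
  onLeft-≼ q (x ∷ pl)         pr = cfg q pl pr

  move-≼ : ∀ q {l l' r r'} h mv → l ≼ l' → r ≼ r' → move q l h r mv ≼ᶜ move q l' h r' mv
  move-≼ q h left  pl pr = onLeft-≼ q pl (h ∷ pr)
  move-≼ q h right pl pr = onRight-≼ q (h ∷ pl) pr
  move-≼ q h stay  pl pr = cfg q pl pr

  writeAction : (zs : Tape k m) → (Fin (length zs) → A) → A → Fin (length zs) →
                Maybe (A × Sym k m × Move)
  writeAction (z ∷ [])     st exit zero    = just (exit , z , stay)
  writeAction (z ∷ _ ∷ _)  st exit zero    = just (st (suc zero) , z , left)
  writeAction (_ ∷ z ∷ zs) st exit (suc j) = writeAction (z ∷ zs) (λ i → st (suc i)) exit j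

  compareAction : (w : Word k) → (Fin (suc (length w)) → A) → A → A → Fin (suc (length w)) → Sym k m →
                  Maybe (A × Sym k m × Move)
  compareAction []       st ok bad zero    (inp a) = just (bad , inp a , stay)
  compareAction []       st ok bad zero    s       = just (ok , s , stay)
  compareAction (c ∷ w)  st ok bad zero    (inp a) with a ≟ c
  ... | Dec.yes _ = just (st (suc zero) , inp a , right)
  ... | Dec.no _  = just (bad , inp a , stay)
  compareAction (c ∷ w)  st ok bad zero    s       = just (bad , s , stay)
  compareAction (_ ∷ w)  st ok bad (suc j) s       = compareAction w (λ i → st (suc i)) ok bad j s

mapState : ∀ {A B : Set} {k m} → (A → B) → Cfg A k m → Cfg B k m
mapState f (cfg q l h r) = cfg (f q) l h r

module _ {A B : Set} {k m : ℕ} (f : A → B) where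

  mapState-onRight : ∀ q l r → mapState {k = k} {m} f (onRight q l r) ≡ onRight (f q) l r
  mapState-onRight q l []      = refl
  mapState-onRight q l (_ ∷ _) = refl

  mapState-onLeft : ∀ q l r → mapState {k = k} {m} f (onLeft q l r) ≡ onLeft (f q) l r
  mapState-onLeft q []      r = refl
  mapState-onLeft q (_ ∷ _) r = refl

  mapState-move : ∀ q l h r mv → mapState {k = k} {m} f (move q l h r mv) ≡ move (f q) l h r mv
  mapState-move q l h r left  = mapState-onLeft q l (h ∷ r)
  mapState-move q l h r right = mapState-onRight q (h ∷ l) r
  mapState-move q l h r stay  = refl

module _ {k : ℕ} (M : TM k) {A : Set} (f : A → Fin (suc (TM.states M))) where

  toConfig : Cfg A k (TM.extra M) → Config k M
  toConfig (cfg q l h r) = conf (f q) l h r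

  doMove≡move : ∀ q l h r mv → doMove M (f q) l h r mv ≡ toConfig (move q l h r mv)
  doMove≡move q []      h r       left  = refl
  doMove≡move q (_ ∷ _) h r       left  = refl
  doMove≡move q []      h []      right = refl
  doMove≡move q []      h (_ ∷ _) right = refl
  doMove≡move q (_ ∷ _) h []      right = refl
  doMove≡move q (_ ∷ _) h (_ ∷ _) right = refl
  doMove≡move q []      h []      stay  = refl
  doMove≡move q []      h (_ ∷ _) stay  = refl
  doMove≡move q (_ ∷ _) h []      stay  = refl
  doMove≡move q (_ ∷ _) h (_ ∷ _) stay  = refl

initConf-pair : ∀ {k} (M : TM k) d x →
                initConf M (d ∷ x ∷ []) ≡ toConfig M (λ q → q) (onRight zero [] (map inp d ++ sep ∷ map inp x))
initConf-pair M []      x = refl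
initConf-pair M (_ ∷ _) x = refl

record FinEncoding (A : Set) : Set where
  field
    size          : ℕ
    encode        : A → Fin size
    decode        : Fin size → A
    decode-encode : ∀ a → decode (encode a) ≡ a

finEncoding-Fin : ∀ n → FinEncoding (Fin n)
finEncoding-Fin n = record { size = n ; encode = λ i → i ; decode = λ i → i ; decode-encode = λ _ → refl }

finEncoding-⊎ : ∀ {A B} → FinEncoding A → FinEncoding B → FinEncoding (A ⊎ B)
finEncoding-⊎ EA EB = record
  { size          = EA.size + EB.size
  ; encode        = join EA.size EB.size ∘ Sum.map EA.encode EB.encode
  ; decode        = [ inj₁ ∘ EA.decode , inj₂ ∘ EB.decode ]′ ∘ splitAt EA.size
  ; decode-encode = decode-encode
  }
  where
  module EA = FinEncoding EA
  module EB = FinEncoding EB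
  decode-encode : ∀ x → [ inj₁ ∘ EA.decode , inj₂ ∘ EB.decode ]′
                          (splitAt EA.size (join EA.size EB.size (Sum.map EA.encode EB.encode x))) ≡ x
  decode-encode x rewrite splitAt-join EA.size EB.size (Sum.map EA.encode EB.encode x) with x
  ... | inj₁ a = cong inj₁ (EA.decode-encode a)
  ... | inj₂ b = cong inj₂ (EB.decode-encode b)

module AbstractTM {k m : ℕ} {A : Set} (δ : A → Sym k m → Maybe (A × Sym k m × Move)) where

  stepᶜ : Cfg A k m → Maybe (Cfg A k m)
  stepᶜ (cfg q ls h r) with δ q h
  ... | nothing            = nothing
  ... | just (q' , s , mv) = just (move q' ls s r mv)

  open Runs stepᶜ public

  step-move : ∀ {q q' s mv} l h r → δ q h ≡ just (q' , s , mv) → cfg q l h r ↝ move q' l s r mv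
  step-move {q} {q'} {s} {mv} l h r e = stepped stepᶜ≡
    where
    stepᶜ≡ : stepᶜ (cfg q l h r) ≡ just (move q' l s r mv)
    stepᶜ≡ rewrite e = refl

  step-right : ∀ {q q' s} l h r → δ q h ≡ just (q' , s , right) → cfg q l h r ↝ onRight q' (s ∷ l) r
  step-right = step-move

  step-left : ∀ {q q' s} l h r → δ q h ≡ just (q' , s , left) → cfg q l h r ↝ onLeft q' l (s ∷ r)
  step-left = step-move

  step-stay : ∀ {q q' s} l h r → δ q h ≡ just (q' , s , stay) → cfg q l h r ↝ cfg q' l s r
  step-stay = step-move

  step-halt : ∀ {q} l h r → δ q h ≡ nothing → Halted (cfg q l h r)
  step-halt {q} l h r e with δ q h
  step-halt {q} l h r refl | _ = refl

  Reaches : Cfg A k m → A → Set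
  Reaches c q = ∃ λ c' → c ↝* c' × Cfg.state c' ≡ q

  ◅◅-Reaches : ∀ {c c' q} → c ↝* c' → Reaches c' q → Reaches c q
  ◅◅-Reaches run (c'' , run' , eq) = c'' , run ◅◅ run' , eq

  stay-into : ∀ {q q'} l h r → δ q h ≡ just (q' , h , stay) → Reaches (cfg q l h r) q'
  stay-into l h r e = _ , step-stay l h r e ◅ ε , refl

  sweep-right : ∀ {q} ws l r → All (λ s → δ q s ≡ just (q , s , right)) ws →
                onRight q l (ws ++ r) ↝* onRight q (ws ʳ++ l) r
  sweep-right []       l r []       = ε
  sweep-right (s ∷ ws) l r (e ∷ es) = step-right l s (ws ++ r) e ◅ sweep-right ws (s ∷ l) r es

  sweep-left : ∀ {q} ws l r → All (λ s → δ q s ≡ just (q , s , left)) ws →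
               onLeft q (ws ++ l) r ↝* onLeft q l (ws ʳ++ r)
  sweep-left []       l r []       = ε
  sweep-left (s ∷ ws) l r (e ∷ es) = step-left (ws ++ l) s r e ◅ sweep-left ws l (s ∷ r) es

  erase-left : ∀ {q} ws l r → All (λ s → δ q s ≡ just (q , blank , left)) ws →
               ∃ λ pad → Blanks pad × onLeft q (ws ++ l) r ↝* onLeft q l (pad ++ r)
  erase-left []       l r []       = [] , [] , ε
  erase-left {q} (s ∷ ws) l r (e ∷ es) with erase-left ws l (blank ∷ r) es
  ... | pad , bs , run = pad ++ blank ∷ [] , ++⁺ bs (refl ∷ []) ,
        step-left (ws ++ l) s r e ◅ subst (λ t → onLeft q (ws ++ l) (blank ∷ r) ↝* onLeft q l t)
                                          (sym (++-assoc pad (blank ∷ []) r)) run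

  write-left : ∀ z zs st exit r → (∀ j s → δ (st j) s ≡ writeAction (z ∷ zs) st exit j) →
               cfg (st zero) [] blank r ↝* onRight exit [] ((z ∷ zs) ʳ++ r)
  write-left z []        st exit r sp = step-stay [] blank r (sp zero blank) ◅ ε
  write-left z (z' ∷ zs) st exit r sp =
    step-left [] blank r (sp zero blank) ◅
    write-left z' zs (λ i → st (suc i)) exit (z ∷ r) (λ j → sp (suc j))

  compare-right : ∀ w st ok bad → (∀ j s → δ (st j) s ≡ compareAction w st ok bad j s) → ∀ l xs →
                  (readInput xs ≡ w → Reaches (onRight (st zero) l xs) ok) ×
                  (readInput xs ≢ w → Reaches (onRight (st zero) l xs) bad)
  compare-right []      st ok bad sp l [] =
    (λ _ → stay-into l blank [] (sp zero blank)) , λ ne → ⊥-elim (ne refl)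
  compare-right []      st ok bad sp l (blank ∷ r) =
    (λ _ → stay-into l blank r (sp zero blank)) , λ ne → ⊥-elim (ne refl)
  compare-right []      st ok bad sp l (sep ∷ r) =
    (λ _ → stay-into l sep r (sp zero sep)) , λ ne → ⊥-elim (ne refl)
  compare-right []      st ok bad sp l (wrk x ∷ r) =
    (λ _ → stay-into l (wrk x) r (sp zero (wrk x))) , λ ne → ⊥-elim (ne refl)
  compare-right []      st ok bad sp l (inp a ∷ r) =
    (λ ()) , λ _ → stay-into l (inp a) r (sp zero (inp a))
  compare-right (c ∷ w) st ok bad sp l [] =
    (λ ()) , λ _ → stay-into l blank [] (sp zero blank)
  compare-right (c ∷ w) st ok bad sp l (blank ∷ r) =
    (λ ()) , λ _ → stay-into l blank r (sp zero blank)
  compare-right (c ∷ w) st ok bad sp l (sep ∷ r) =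
    (λ ()) , λ _ → stay-into l sep r (sp zero sep)
  compare-right (c ∷ w) st ok bad sp l (wrk x ∷ r) =
    (λ ()) , λ _ → stay-into l (wrk x) r (sp zero (wrk x))
  compare-right (c ∷ w) st ok bad sp l (inp a ∷ r) with a ≟ c | sp zero (inp a)
  ... | Dec.no a≢c   | e = (λ { refl → ⊥-elim (a≢c refl) }) , λ _ → stay-into l (inp a) r e
  ... | Dec.yes refl | e with compare-right w (λ i → st (suc i)) ok bad (λ j → sp (suc j)) (inp a ∷ l) r
  ...   | matches , differs = (λ { refl → first (matches refl) }) , λ ne → first (differs (ne ∘ cong (a ∷_)))
    where
    first : ∀ {q} → Reaches (onRight (st (suc zero)) (inp a ∷ l) r) q → Reaches (cfg (st zero) l (inp a) r) q
    first (c' , run , eq) = c' , step-right l (inp a) r e ◅ run , eq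

  step-≼ : ∀ {c c'} → c ≼ᶜ c' → Pointwise _≼ᶜ_ (stepᶜ c) (stepᶜ c')
  step-≼ (cfg q {h = h} pl pr) with δ q h
  ... | nothing            = nothing
  ... | just (q' , s , mv) = just (move-≼ q' s mv pl pr)

  ↝*-≼ : ∀ {c c' h} → c ≼ᶜ c' → c ↝* h → ∃ λ h' → c' ↝* h' × h ≼ᶜ h'
  ↝*-≼ {c' = c'} p ε = c' , ε , p
  ↝*-≼ p (stepped s ◅ run) with just-inv (subst (λ x → Pointwise _≼ᶜ_ x _) s (step-≼ p))
  ... | c₁' , s' , p₁ with ↝*-≼ p₁ run
  ...   | h' , run' , ph = h' , stepped s' ◅ run' , ph


-- Counting words

module _ {k : ℕ} where

  allWords-suc : ∀ n → allWords k (suc n) ≡ cartesianProductWith _∷_ (allFin k) (allWords k n)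
  allWords-suc n = concatMap≡cartesianProductWith _∷_ (allFin k) (allWords k n)

  length-allWords : ∀ n → length (allWords k n) ≡ k ^ n
  length-allWords zero    = refl
  length-allWords (suc n) = begin
    length (allWords k (suc n))                                  ≡⟨ cong length (allWords-suc n) ⟩
    length (cartesianProductWith _∷_ (allFin k) (allWords k n))
      ≡⟨ length-cartesianProductWith _∷_ (allFin k) (allWords k n) ⟩
    length (allFin k) * length (allWords k n)
      ≡⟨ cong₂ _*_ (length-tabulate {n = k} (λ i → i)) (length-allWords n) ⟩
    k * k ^ n                                                    ∎
    where open ≡-Reasoning

  allWords-length : ∀ n → All (λ w → length w ≡ n) (allWords k n)
  allWords-length zero    = refl ∷ []
  allWords-length (suc n) rewrite allWords-suc n =
    All-cartesianProductWith _∷_ (allFin k) _ (λ _ → All.map (cong suc) (allWords-length n))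

  allWords-unique : ∀ n → Unique (allWords k n)
  allWords-unique zero    = [] ∷ []
  allWords-unique (suc n) rewrite allWords-suc n =
    Unique.cartesianProductWith⁺ _∷_ ∷-injective (Unique.allFin⁺ k) (allWords-unique n)

  module _ (L : Language k) where

    progCount≤ : ∀ n → progCount L n ≤ k ^ n
    progCount≤ n = ≤-trans (length-filter (Language.isProg? L) (allWords k n)) (≤-reflexive (length-allWords n))

    extensions-fraction : ∀ (pre : Word k) (P : Word k → Set) → (∀ r → P (pre ++ r)) →
      ∀ c → k ^ length pre ≤ suc c → ∀ n → length pre ≤ n →
      ∃ λ qs → Unique qs × All (λ q → length q ≡ n × P q) qs × progCount L n ≤ suc c * length qs
    extensions-fraction pre P P-ext c pre-fraction n pre≤n =
      map (pre ++_) (allWords k j) ,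
      Unique.map⁺ (++-cancelˡ pre _ _) (allWords-unique j) ,
      map⁺ (All.map (λ {r} length-r → length-extension r length-r , P-ext r) (allWords-length j)) ,
      (begin
        progCount L n                                           ≤⟨ progCount≤ n ⟩
        k ^ n                                                   ≡⟨ cong (k ^_) (sym (m+[n∸m]≡n pre≤n)) ⟩
        k ^ (length pre + j)                                    ≡⟨ ^-distribˡ-+-* k (length pre) j ⟩
        k ^ length pre * k ^ j                                  ≤⟨ *-monoˡ-≤ (k ^ j) pre-fraction ⟩
        suc c * k ^ j                                           ≡⟨ cong (suc c *_) (sym (length-allWords j)) ⟩
        suc c * length (allWords k j)
          ≡⟨ cong (suc c *_) (sym (length-map (pre ++_) (allWords k j))) ⟩
        suc c * length (map (pre ++_) (allWords k j))           ∎)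
      where
      j = n ∸ length pre
      length-extension : ∀ r → length r ≡ j → length (pre ++ r) ≡ n
      length-extension r length-r =
        trans (length-++ pre) (trans (cong (length pre +_) length-r) (m+[n∸m]≡n pre≤n))
      open ≤-Reasoning


-- The diagonal machine

HaltsIf : Bool → Set → Set
HaltsIf true  P = P
HaltsIf false P = ¬ P

HaltsIf-⇔ : ∀ b {P Q : Set} → P ⇔ Q → HaltsIf b P → HaltsIf b Q
HaltsIf-⇔ true  P⇔Q p  = Equivalence.to P⇔Q p
HaltsIf-⇔ false P⇔Q ¬p = ¬p ∘ Equivalence.from P⇔Q

module DiagonalMachine {k' : ℕ} (U : TM (suc (suc k'))) (T w : Word (suc (suc k'))) (b : Bool) where

  k m : ℕ
  k = suc (suc k')
  m = TM.extra U

  inputs : Word k → Tape k m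
  inputs = map inp

  all-inputs : ∀ {P : Sym k m → Set} → (∀ c → P (inp c)) → ∀ xs → All P (inputs xs)
  all-inputs pf xs = map⁺ (universal pf xs)

  -- The 0 tags mark the symbols of a still to be copied in front of the data, 1 marks the end;
  -- a is stored reversed because the machine rebuilds it from right to left.
  tagged : Word k → Word k
  tagged []       = []
  tagged (c ∷ cs) = 0F ∷ c ∷ tagged cs

  dataSegment : Word k → Word k → Word k
  dataSegment a r = tagged (reverse a) ++ 1F ∷ r

  header : Tape k m
  header = sep ∷ reverse (inputs T)

  State : Set
  State = Fin 11 ⊎ Fin k ⊎ Fin (length header) ⊎ Fin (suc (TM.states U)) ⊎ Fin (suc (length w))

  pattern seekEnd       = inj₁ 0F
  pattern eraseInput    = inj₁ 1F
  pattern rewind        = inj₁ 2F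
  pattern fetch         = inj₁ 3F
  pattern pick          = inj₁ 4F
  pattern returnRight   = inj₁ 5F
  pattern skip          = inj₁ 6F
  pattern seekStart     = inj₁ 7F
  pattern matched       = inj₁ 8F
  pattern mismatched    = inj₁ 9F
  pattern loop          = inj₁ (suc 9F)
  pattern carryLeft c   = inj₂ (inj₁ c)
  pattern writeHeader j = inj₂ (inj₂ (inj₁ j))
  pattern simulate q    = inj₂ (inj₂ (inj₂ (inj₁ q)))
  pattern compare j     = inj₂ (inj₂ (inj₂ (inj₂ j)))

  haltIf : Bool → Sym k m → Maybe (State × Sym k m × Move)
  haltIf true  s = nothing
  haltIf false s = just (loop , s , stay)

  simulateAction : Sym k m → Maybe (Fin (suc (TM.states U)) × Sym k m × Move) → Maybe (State × Sym k m × Move)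
  simulateAction s nothing              = just (compare zero , s , stay)
  simulateAction s (just (q , s' , mv)) = just (simulate q , s' , mv)

  transition : State → Sym k m → Maybe (State × Sym k m × Move)
  transition seekEnd         (inp c)  = just (seekEnd , inp c , right)
  transition seekEnd         sep      = just (seekEnd , sep , right)
  transition seekEnd         s        = just (eraseInput , s , left)
  transition eraseInput      (inp c)  = just (eraseInput , blank , left)
  transition eraseInput      sep      = just (rewind , blank , left)
  transition eraseInput      _        = nothing
  transition rewind          (inp c)  = just (rewind , inp c , left)
  transition rewind          blank    = just (fetch , blank , right)
  transition rewind          _        = nothing
  transition fetch           (inp 0F) = just (pick , sep , right)
  transition fetch           (inp 1F) = just (seekStart , inp 1F , left)
  transition fetch           _        = nothing
  transition pick            (inp c)  = just (carryLeft c , inp c , left)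
  transition pick            _        = nothing
  transition (carryLeft c)   (inp c') = just (carryLeft c , inp c' , left)
  transition (carryLeft c)   sep      = just (carryLeft c , sep , left)
  transition (carryLeft c)   blank    = just (returnRight , inp c , right)
  transition (carryLeft c)   (wrk _)  = nothing
  transition returnRight     (inp c)  = just (returnRight , inp c , right)
  transition returnRight     sep      = just (skip , inp 0F , right)
  transition returnRight     _        = nothing
  transition skip            s        = just (fetch , s , right)
  transition seekStart       (inp c)  = just (seekStart , inp c , left)
  transition seekStart       blank    = just (writeHeader zero , blank , stay)
  transition seekStart       _        = nothing
  transition (writeHeader j) s        = writeAction header (λ i → writeHeader i) (simulate zero) j
  transition (simulate q)    s        = simulateAction s (TM.δ U q s)
  transition (compare j)     s        = compareAction w (λ i → compare i) matched mismatched j s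
  transition matched         s        = haltIf b s
  transition mismatched      s        = haltIf (not b) s
  transition loop            s        = just (loop , s , stay)

  open AbstractTM transition
  module ↝-Reasoning = StarReasoning _↝_

  initial : Word k → Word k → Cfg State k m
  initial d x = onRight seekEnd [] (inputs d ++ sep ∷ inputs x)

  erase-input : ∀ d x → ∃ λ pad → Blanks pad × initial d x ↝* onRight fetch (blank ∷ []) (inputs d ++ pad)
  erase-input d x = blank ∷ pad ++ blank ∷ [] , refl ∷ ++⁺ pad-blanks (refl ∷ []) , (begin
    initial d x                                      ≡⟨ cong (onRight seekEnd []) (sym (++-identityʳ tape)) ⟩
    onRight seekEnd [] (tape ++ [])
      ⟶*⟨ sweep-right tape [] [] (++⁺ (all-inputs (λ _ → refl) d) (refl ∷ all-inputs (λ _ → refl) x)) ⟩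
    cfg seekEnd (tape ʳ++ []) blank []               ⟶⟨ step-left (tape ʳ++ []) blank [] refl ⟩
    onLeft eraseInput (tape ʳ++ []) (blank ∷ [])
      ≡⟨ cong (λ t → onLeft eraseInput t (blank ∷ [])) tape-reversed ⟩
    onLeft eraseInput (X ++ sep ∷ D) (blank ∷ [])    ⟶*⟨ erasing ⟩
    cfg eraseInput D sep (pad ++ blank ∷ [])         ⟶⟨ step-left D sep (pad ++ blank ∷ []) refl ⟩
    onLeft rewind D (blank ∷ pad ++ blank ∷ [])
      ≡⟨ cong (λ t → onLeft rewind t (blank ∷ pad ++ blank ∷ [])) (sym (++-identityʳ D)) ⟩
    onLeft rewind (D ++ []) (blank ∷ pad ++ blank ∷ [])
      ⟶*⟨ sweep-left D [] _ (ʳ++⁺ (all-inputs (λ _ → refl) d) []) ⟩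
    cfg rewind [] blank (D ʳ++ blank ∷ pad ++ blank ∷ [])
      ⟶⟨ step-right [] blank _ refl ⟩
    onRight fetch (blank ∷ []) (D ʳ++ blank ∷ pad ++ blank ∷ [])
      ≡⟨ cong (onRight fetch (blank ∷ [])) (ʳ++-ʳ++ (inputs d)) ⟩
    onRight fetch (blank ∷ []) (inputs d ++ blank ∷ pad ++ blank ∷ []) ∎)
    where
    tape = inputs d ++ sep ∷ inputs x
    X    = reverse (inputs x)
    D    = reverse (inputs d)
    tape-reversed : tape ʳ++ [] ≡ X ++ sep ∷ D
    tape-reversed = trans (++-ʳ++ (inputs d)) (ʳ++-defn (inputs x))
    erased     = erase-left X (sep ∷ D) (blank ∷ []) (ʳ++⁺ (all-inputs (λ _ → refl) x) [])
    pad        = proj₁ erased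
    pad-blanks = proj₁ (proj₂ erased)
    erasing    = proj₂ (proj₂ erased)
    open ↝-Reasoning

  tagged-++ : ∀ u v → tagged (u ++ v) ≡ tagged u ++ tagged v
  tagged-++ []      v = refl
  tagged-++ (c ∷ u) v = cong (λ t → 0F ∷ c ∷ t) (tagged-++ u v)

  -- Left of the head the tape reads reverse u · tagged u (u is the copied part of reverse a),
  -- right of it tagged v · 1 · r · pad (v is still to be copied).
  copying : Word k → Word k → Tape k m → Tape k m → Word k → Cfg State k m
  copying u v e pad r = onRight fetch (inputs (tagged u ʳ++ u) ++ e) (inputs (tagged v ++ 1F ∷ r) ++ pad)

  copied-tape : ∀ u c → inp c ∷ inp 0F ∷ (inputs (tagged u ʳ++ u) ʳ++ []) ʳ++ inp c ∷ [] ≡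
                        inputs (tagged (u ++ c ∷ []) ʳ++ (u ++ c ∷ [])) ++ []
  copied-tape u c = sym (begin
    inputs (tagged (u ++ c ∷ []) ʳ++ (u ++ c ∷ [])) ++ []
      ≡⟨ ++-identityʳ _ ⟩
    inputs (tagged (u ++ c ∷ []) ʳ++ (u ++ c ∷ []))
      ≡⟨ cong (λ t → inputs (t ʳ++ (u ++ c ∷ []))) (tagged-++ u (c ∷ [])) ⟩
    inputs ((tagged u ++ 0F ∷ c ∷ []) ʳ++ (u ++ c ∷ []))
      ≡⟨ cong inputs (++-ʳ++ (tagged u)) ⟩
    inp c ∷ inp 0F ∷ inputs (tagged u ʳ++ (u ++ c ∷ []))
      ≡⟨ cong (λ t → inp c ∷ inp 0F ∷ inputs t) (ʳ++-++ (tagged u)) ⟩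
    inp c ∷ inp 0F ∷ inputs (copied ++ c ∷ [])
      ≡⟨ cong (λ t → inp c ∷ inp 0F ∷ t) (map-++ inp copied (c ∷ [])) ⟩
    inp c ∷ inp 0F ∷ inputs copied ++ inp c ∷ []
      ≡⟨ cong (λ t → inp c ∷ inp 0F ∷ t) (sym (ʳ++-ʳ++ (inputs copied))) ⟩
    inp c ∷ inp 0F ∷ (inputs copied ʳ++ []) ʳ++ inp c ∷ [] ∎)
    where
    copied = tagged u ʳ++ u
    open ≡-Reasoning

  copy-step : ∀ u c v {e} pad r → LeftEnd e → copying u (c ∷ v) e pad r ↝* copying (u ++ c ∷ []) v [] pad r
  copy-step u c v {e} pad r end = begin
    cfg fetch (L ++ e) (inp 0F) (inp c ∷ R)               ⟶⟨ step-right (L ++ e) (inp 0F) (inp c ∷ R) refl ⟩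
    cfg pick (sep ∷ L ++ e) (inp c) R                     ⟶⟨ step-left (sep ∷ L ++ e) (inp c) R refl ⟩
    onLeft (carryLeft c) (sep ∷ L ++ e) (inp c ∷ R)
      ⟶*⟨ sweep-left (sep ∷ L) e (inp c ∷ R) (refl ∷ all-inputs (λ _ → refl) copied) ⟩
    onLeft (carryLeft c) e (L ʳ++ sep ∷ inp c ∷ R)        ≡⟨ onLeft-LeftEnd (carryLeft c) _ end ⟩
    cfg (carryLeft c) [] blank (L ʳ++ sep ∷ inp c ∷ R)    ⟶⟨ step-right [] blank _ refl ⟩
    onRight returnRight (inp c ∷ []) (L ʳ++ sep ∷ inp c ∷ R)
      ≡⟨ cong (onRight returnRight (inp c ∷ [])) (ʳ++-++ L) ⟩
    onRight returnRight (inp c ∷ []) ((L ʳ++ []) ++ sep ∷ inp c ∷ R)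
      ⟶*⟨ sweep-right (L ʳ++ []) (inp c ∷ []) _ (ʳ++⁺ (all-inputs (λ _ → refl) copied) []) ⟩
    cfg returnRight ((L ʳ++ []) ʳ++ inp c ∷ []) sep (inp c ∷ R)    ⟶⟨ step-right _ sep _ refl ⟩
    cfg skip (inp 0F ∷ (L ʳ++ []) ʳ++ inp c ∷ []) (inp c) R        ⟶⟨ step-right _ (inp c) R refl ⟩
    onRight fetch (inp c ∷ inp 0F ∷ (L ʳ++ []) ʳ++ inp c ∷ []) R
      ≡⟨ cong (λ t → onRight fetch t R) (copied-tape u c) ⟩
    copying (u ++ c ∷ []) v [] pad r                               ∎
    where
    copied = tagged u ʳ++ u
    L    = inputs copied
    R    = inputs (tagged v ++ 1F ∷ r) ++ pad
    open ↝-Reasoning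

  copy-all : ∀ v u {e} pad r → LeftEnd e →
             ∃ λ e' → LeftEnd e' × copying u v e pad r ↝* copying (u ++ v) [] e' pad r
  copy-all []      u {e} pad r end =
    e , end , subst (λ t → copying u [] e pad r ↝* copying t [] e pad r) (sym (++-identityʳ u)) ε
  copy-all (c ∷ v) u     pad r end with copy-all v (u ++ c ∷ []) pad r []
  ... | e' , end' , run =
    e' , end' ,
    copy-step u c v pad r end ◅◅
    subst (λ t → copying (u ++ c ∷ []) v [] pad r ↝* copying t [] e' pad r) (++-assoc u (c ∷ []) v) run

  start-simulation : ∀ u {e} pad r → LeftEnd e → copying u [] e pad r ↝*
    onRight (simulate zero) [] (inputs T ++ sep ∷ inputs (tagged u ʳ++ u) ʳ++ inp 1F ∷ inputs r ++ pad)
  start-simulation u {e} pad r end = begin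
    cfg fetch (L ++ e) (inp 1F) R              ⟶⟨ step-left (L ++ e) (inp 1F) R refl ⟩
    onLeft seekStart (L ++ e) (inp 1F ∷ R)     ⟶*⟨ sweep-left L e (inp 1F ∷ R) (all-inputs (λ _ → refl) _) ⟩
    onLeft seekStart e program                 ≡⟨ onLeft-LeftEnd seekStart program end ⟩
    cfg seekStart [] blank program             ⟶⟨ step-stay [] blank program refl ⟩
    cfg (writeHeader zero) [] blank program
      ⟶*⟨ write-left sep (reverse (inputs T)) (λ i → writeHeader i) (simulate zero) program (λ _ _ → refl) ⟩
    onRight (simulate zero) [] (header ʳ++ program)  ≡⟨ cong (onRight (simulate zero) []) (ʳ++-ʳ++ (inputs T)) ⟩
    onRight (simulate zero) [] (inputs T ++ sep ∷ program) ∎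
    where
    L       = inputs (tagged u ʳ++ u)
    R       = inputs r ++ pad
    program = L ʳ++ inp 1F ∷ R
    open ↝-Reasoning

  program-restored : ∀ a r pad →
    inputs (tagged (reverse a) ʳ++ reverse a) ʳ++ inp 1F ∷ inputs r ++ pad ≡ inputs (a ++ dataSegment a r) ++ pad
  program-restored a r pad = begin
    inputs (tagged ra ʳ++ ra) ʳ++ R                  ≡⟨ cong (_ʳ++ R) (map-ʳ++ inp (tagged ra)) ⟩
    (inputs (tagged ra) ʳ++ inputs ra) ʳ++ R         ≡⟨ ʳ++-ʳ++ (inputs (tagged ra)) ⟩
    inputs ra ʳ++ inputs (tagged ra) ++ R            ≡⟨ cong (_ʳ++ (inputs (tagged ra) ++ R)) (map-ʳ++ inp a) ⟩
    (inputs a ʳ++ []) ʳ++ inputs (tagged ra) ++ R    ≡⟨ ʳ++-ʳ++ (inputs a) ⟩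
    inputs a ++ inputs (tagged ra) ++ R
      ≡⟨ cong (inputs a ++_) (sym (++-assoc (inputs (tagged ra)) _ pad)) ⟩
    inputs a ++ (inputs (tagged ra) ++ inputs (1F ∷ r)) ++ pad
      ≡⟨ cong (λ t → inputs a ++ t ++ pad) (sym (map-++ inp (tagged ra) _)) ⟩
    inputs a ++ inputs (dataSegment a r) ++ pad      ≡⟨ sym (++-assoc (inputs a) _ pad) ⟩
    (inputs a ++ inputs (dataSegment a r)) ++ pad    ≡⟨ cong (_++ pad) (sym (map-++ inp a _)) ⟩
    inputs (a ++ dataSegment a r) ++ pad             ∎
    where
    ra = reverse a
    R  = inp 1F ∷ inputs r ++ pad
    open ≡-Reasoning

  setup : ∀ a r x → ∃ λ pad → Blanks pad ×
    initial (dataSegment a r) x ↝* onRight (simulate zero) [] (inputs T ++ sep ∷ inputs (a ++ dataSegment a r) ++ pad)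
  setup a r x with erase-input (dataSegment a r) x
  ... | pad , blanks , erasing with copy-all (reverse a) [] pad r blank
  ...   | e , end , copying-run =
    pad , blanks ,
    erasing ◅◅ copying-run ◅◅
    subst (λ t → copying (reverse a) [] e pad r ↝* onRight (simulate zero) [] (inputs T ++ sep ∷ t))
          (program-restored a r pad) (start-simulation (reverse a) pad r end)

  embedU : Config k U → Cfg State k m
  embedU (conf q l h r) = cfg (simulate q) l h r

  startCompare : Config k U → Cfg State k m
  startCompare (conf q l h r) = cfg (compare zero) l h r

  simulate-step : ∀ c → stepᶜ (embedU c) ≡ just (maybe embedU (startCompare c) (step U c))
  simulate-step (conf q l h r) with TM.δ U q h
  ... | nothing            = refl
  ... | just (q' , s , mv) = cong just (sym (begin
    embedU (doMove U q' l s r mv)                   ≡⟨ cong embedU (doMove≡move U (λ i → i) q' l s r mv) ⟩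
    mapState (λ i → simulate i) (move q' l s r mv)  ≡⟨ mapState-move (λ i → simulate i) q' l s r mv ⟩
    move (simulate q') l s r mv                     ∎))
    where open ≡-Reasoning

  module RunU = TMRuns U

  simulate-run : ∀ {c h} → c RunU.↝* h → RunU.Halted h → embedU c ↝* startCompare h
  simulate-run {h = h} ε halted =
    stepped (trans (simulate-step h) (cong (λ s → just (maybe embedU (startCompare h) s)) halted)) ◅ ε
  simulate-run {c} (RunU.stepped s ◅ run) halted =
    stepped (trans (simulate-step c) (cong (λ s → just (maybe embedU (startCompare c) s)) s)) ◅
    simulate-run run halted

  embedU-initConf : ∀ q →
    embedU (initConf U (T ∷ q ∷ [])) ≡ onRight (simulate zero) [] (inputs T ++ sep ∷ inputs q)
  embedU-initConf q = trans (cong embedU (initConf-pair U T q))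
                            (mapState-onRight (λ i → simulate i) zero [] (inputs T ++ sep ∷ inputs q))

  -- Trailing blanks, left where the input was erased, do not change the run of U.
  simulation-reaches-comparison : ∀ q {pad} o → Blanks pad → TMEval U (T ∷ q ∷ []) o →
    ∃ λ l → ∃ λ xs → readInput xs ≡ o ×
      onRight (simulate zero) [] (inputs T ++ sep ∷ inputs q ++ pad) ↝* onRight (compare zero) l xs
  simulation-reaches-comparison q {pad} o blanks (t , c , ex , out) with RunU.exec⇒↝* t _ c ex
  ... | runU , halted
    with ↝*-≼ (onRight-≼ (simulate zero) ([] []) (≼-++ (inputs T ++ sep ∷ inputs q) blanks))
              (subst (_↝* startCompare c) (embedU-initConf q) (simulate-run runU halted))
  ... | h , run , cfg _ {l' = l} {h = hd} {r' = r} _ r≼ =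
    l , hd ∷ r ,
    trans (sym (readInput-≼ (hd ∷ r≼))) (trans (sym (readOut≡readInput U _)) out) ,
    subst (λ t → onRight (simulate zero) [] t ↝* h) (++-assoc (inputs T) _ pad) run

  reaches-comparison : ∀ a r x o → TMEval U (T ∷ (a ++ dataSegment a r) ∷ []) o →
    ∃ λ l → ∃ λ xs → readInput xs ≡ o × initial (dataSegment a r) x ↝* onRight (compare zero) l xs
  reaches-comparison a r x o ev with setup a r x
  ... | pad , blanks , setting-up with simulation-reaches-comparison (a ++ dataSegment a r) o blanks ev
  ...   | l , xs , out , simulating = l , xs , out , setting-up ◅◅ simulating

  stateEncoding : FinEncoding State
  stateEncoding = finEncoding-⊎ (finEncoding-Fin 11) (finEncoding-⊎ (finEncoding-Fin k)
                    (finEncoding-⊎ (finEncoding-Fin _) (finEncoding-⊎ (finEncoding-Fin _) (finEncoding-Fin _))))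

  open FinEncoding stateEncoding using (size; encode; decode; decode-encode)

  encodeAction : State × Sym k m × Move → Fin size × Sym k m × Move
  encodeAction (q , s , mv) = encode q , s , mv

  machine : TM k
  machine = record
    { states = pred size
    ; extra  = m
    ; δ      = λ q s → Maybe.map encodeAction (transition (decode q) s)
    }

  toMachine : Cfg State k m → Config k machine
  toMachine = toConfig machine encode

  toMachine-commutes : ∀ c → step machine (toMachine c) ≡ Maybe.map toMachine (stepᶜ c)
  toMachine-commutes (cfg q l h r) rewrite decode-encode q with transition q h
  ... | nothing            = refl
  ... | just (q' , s , mv) = cong just (doMove≡move machine encode q' l s r mv)

  module RunM = TMRuns machine
  open Simulation stepᶜ (step machine) toMachine toMachine-commutes

  toMachine-initial : ∀ d x → toMachine (initial d x) ≡ initConf machine (d ∷ x ∷ [])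
  toMachine-initial d x =
    trans (cong (toConfig machine (λ i → i)) (mapState-onRight encode seekEnd [] (inputs d ++ sep ∷ inputs x)))
          (sym (initConf-pair machine d x))

  HaltsOn : Word k → Word k → Set
  HaltsOn d x = ∃ λ y → TMEval machine (d ∷ x ∷ []) y

  halting-run⇒HaltsOn : ∀ {d x c} → initial d x ↝* c → Halted c → HaltsOn d x
  halting-run⇒HaltsOn {d} {x} {c} run halted with RunM.↝*⇒exec (map-↝* run) (map-Halted {c} halted)
  ... | t , ex = readOut machine (Config.hd (toMachine c) ∷ Config.rgt (toMachine c)) , t , toMachine c ,
                 subst (λ c₀ → exec machine t c₀ ≡ just (toMachine c)) (toMachine-initial d x) ex , refl

  HaltsOn⇒halting-run : ∀ {d x} → HaltsOn d x → ∃ λ g → initial d x ↝* g × Halted g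
  HaltsOn⇒halting-run {d} {x} (_ , t , c , ex , _) with RunM.exec⇒↝* t _ c ex
  ... | run , halted = reflect-halting (initial d x) (subst (RunM._↝* c) (sym (toMachine-initial d x)) run) halted

  loop-diverges : ∀ {l h r g} → cfg loop l h r ↝* g → ¬ Halted g
  loop-diverges ε                    ()
  loop-diverges (stepped refl ◅ run) = loop-diverges run

  reaches-halting : ∀ {d x q} → (∀ s → transition q s ≡ nothing) → Reaches (initial d x) q → HaltsOn d x
  reaches-halting {q = q} halts (cfg _ l h r , run , refl) =
    halting-run⇒HaltsOn run (step-halt {q = q} l h r (halts h))

  reaches-looping : ∀ {d x q} → (∀ s → transition q s ≡ just (loop , s , stay)) → Reaches (initial d x) q →
                    ¬ HaltsOn d x
  reaches-looping {q = q} loops (cfg _ l h r , run , refl) halting with HaltsOn⇒halting-run halting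
  ... | g , run-g , halted-g =
    loop-diverges (↝*-det run-g halted-g (run ◅◅ step-stay {q = q} l h r (loops h) ◅ ε)) halted-g

  reaches-haltIf : ∀ b' {d x q} → (∀ s → transition q s ≡ haltIf b' s) → Reaches (initial d x) q →
                   HaltsIf b' (HaltsOn d x)
  reaches-haltIf true  = reaches-halting
  reaches-haltIf false = reaches-looping

  behaviour : ∀ a r x o → TMEval U (T ∷ (a ++ dataSegment a r) ∷ []) o →
    (o ≡ w → HaltsIf b (HaltsOn (dataSegment a r) x)) × (o ≢ w → HaltsIf (not b) (HaltsOn (dataSegment a r) x))
  behaviour a r x o ev with reaches-comparison a r x o ev
  ... | l , xs , out , run with compare-right w (λ i → compare i) matched mismatched (λ _ _ → refl) l xs
  ...   | on-match , on-mismatch =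
    (λ o≡w → reaches-haltIf b (λ _ → refl) (◅◅-Reaches run (on-match (trans out o≡w)))) ,
    (λ o≢w → reaches-haltIf (not b) (λ _ → refl) (◅◅-Reaches run (on-mismatch (o≢w ∘ trans (sym out)))))


-- Hard instances

module _ {k' : ℕ} (L : Language (suc (suc k'))) (eof : EOFDataSegment L) (X : Variant) (T : Word (suc (suc k')))
         where

  open Language L
  open EOFDataSegment eof

  Contrary : Word (suc (suc k')) → Word (suc (suc k')) → Bool → Set
  Contrary q w b = ∀ o → Eval T q o →
    (o ≡ w → HaltsIf b (XHalts L X q)) × (o ≢ w → HaltsIf (not b) (XHalts L X q))

  diagonal : IsProg T → ∀ w b → ∃ λ pre → ∀ r → IsProg (pre ++ r) × Contrary (pre ++ r) w b
  diagonal T-prog w b = pre , λ r → subst (λ q → IsProg q × Contrary q w b) (sym (pre-++ r)) (contrary r)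
    where
    U = proj₁ simulable
    open DiagonalMachine U T w b
    a        = proj₁ (readData machine)
    actual   = proj₁ (proj₂ (readData machine))
    realises = proj₂ (proj₂ (readData machine))
    pre = a ++ tagged (reverse a) ++ 1F ∷ []
    pre-++ : ∀ r → pre ++ r ≡ a ++ dataSegment a r
    pre-++ r = trans (++-assoc a _ r) (cong (a ++_) (++-assoc (tagged (reverse a)) _ r))
    contrary : ∀ r → IsProg (a ++ dataSegment a r) × Contrary (a ++ dataSegment a r) w b
    contrary r =
      Equivalence.from (programs q) (a , d , actual , refl) ,
      λ o ev → let on-match , on-mismatch = behaviour a r x o (Equivalence.to (proj₂ simulable T q o T-prog) ev)
               in HaltsIf-⇔ b halts⇔ ∘ on-match , HaltsIf-⇔ (not b) halts⇔ ∘ on-mismatch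
      where
      d = dataSegment a r
      q = a ++ d
      x = instInput X q
      halts⇔ : HaltsOn d x ⇔ XHalts L X q
      halts⇔ = mk⇔ (λ (y , ev) → y , Equivalence.from (realises d x y) ev)
                   (λ (y , ev) → y , Equivalence.to (realises d x y) ev)

  module _ (tw : ThreeWay L X T) where

    contrary-yes⇒hard-halting : ∀ q → IsProg q → Contrary q yes false →
                                IsProg q × Hard L X T q × XHalts L X q
    contrary-yes⇒hard-halting q prog contra with proj₂ tw q prog
    ... | inj₁ said-yes , yes-sound , _      = ⊥-elim (proj₁ (contra yes said-yes) refl (yes-sound said-yes))
    ... | inj₂ (inj₁ said-no) , _ , no-sound = ⊥-elim (no-sound said-no (proj₂ (contra no said-no) (yes≢no ∘ sym)))
    ... | inj₂ (inj₂ said-idk) , _ , _       = prog , said-idk , proj₂ (contra idk said-idk) (yes≢idk ∘ sym)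

    contrary-no⇒hard-nonhalting : ∀ q → IsProg q → Contrary q no true →
                                  IsProg q × Hard L X T q × ¬ XHalts L X q
    contrary-no⇒hard-nonhalting q prog contra with proj₂ tw q prog
    ... | inj₁ said-yes , yes-sound , _      = ⊥-elim (proj₂ (contra yes said-yes) yes≢no (yes-sound said-yes))
    ... | inj₂ (inj₁ said-no) , _ , no-sound = ⊥-elim (no-sound said-no (proj₁ (contra no said-no) refl))
    ... | inj₂ (inj₂ said-idk) , _ , _       = prog , said-idk , proj₂ (contra idk said-idk) (no≢idk ∘ sym)

    hard-halting-bound : ∃ λ pre → ∀ c → suc (suc k') ^ length pre ≤ suc c → ∀ n → length pre ≤ n →
                         HardHaltBound L X T c n
    hard-halting-bound =
      pre , extensions-fraction L pre (λ q → IsProg q × Hard L X T q × XHalts L X q)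
              (λ r → contrary-yes⇒hard-halting (pre ++ r) (proj₁ (contrary r)) (proj₂ (contrary r)))
      where
      pre      = proj₁ (diagonal (proj₁ tw) yes false)
      contrary = proj₂ (diagonal (proj₁ tw) yes false)

    hard-nonhalting-bound : ∃ λ pre → ∀ c → suc (suc k') ^ length pre ≤ suc c → ∀ n → length pre ≤ n →
                            HardNonHaltBound L X T c n
    hard-nonhalting-bound =
      pre , extensions-fraction L pre (λ q → IsProg q × Hard L X T q × ¬ XHalts L X q)
              (λ r → contrary-no⇒hard-nonhalting (pre ++ r) (proj₁ (contrary r)) (proj₂ (contrary r)))
      where
      pre      = proj₁ (diagonal (proj₁ tw) no true)
      contrary = proj₂ (diagonal (proj₁ tw) no true)

theorem4 : (k : ℕ) → 2 ≤ k → (L : Language k) → EOFDataSegment L → HasBlank L →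
    (X : Variant) → (T : Word k) → ThreeWay L X T →
    ∃ λ c → ∃ λ n₀ → (n : ℕ) → n₀ ≤ n →
      HardHaltBound L X T c n × HardNonHaltBound L X T c n
theorem4 (suc (suc k')) (s≤s (s≤s z≤n)) L eof _ X T tw =
  c , ℓ₁ ⊔ ℓ₂ , λ n n₀≤n →
    halting    c (≤-trans (m≤m+n (k ^ ℓ₁) (k ^ ℓ₂)) (n≤1+n c)) n (≤-trans (m≤m⊔n ℓ₁ ℓ₂) n₀≤n) ,
    nonhalting c (≤-trans (m≤n+m (k ^ ℓ₂) (k ^ ℓ₁)) (n≤1+n c)) n (≤-trans (m≤n⊔m ℓ₁ ℓ₂) n₀≤n)
  where
  k          = suc (suc k')
  ℓ₁         = length (proj₁ (hard-halting-bound L eof X T tw))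
  halting    = proj₂ (hard-halting-bound L eof X T tw)
  ℓ₂         = length (proj₁ (hard-nonhalting-bound L eof X T tw))
  nonhalting = proj₂ (hard-nonhalting-bound L eof X T tw)
  c          = k ^ ℓ₁ + k ^ ℓ₂
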